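{- If $s$ is a $+$-term, then $s\lesssim_{ACh}t$ if and only if $s\lesssim_{AC}t\downarrow_{R_h,AC}$.
   Context: Terms are over $\{+,h,0\}$, variables and free constants. A $+$-term is a term containing only variables, constants and $+$, with no occurrence of $h$. $ACh$ is the theory generated by associativity and commutativity of $+$ and $h(x+y)\approx h(x)+h(y)$; $AC$ is associativity and commutativity of $+$. For a theory $E$, $s\lesssim_E t$ means that $s$ $E$-matches $t$: there is a substitution $\sigma$ with $s\sigma=_E t$. $R_h$ is the rule $h(x+y)\to h(x)+h(y)$ modulo $AC$, and $t\downarrow_{R_h,AC}$ is the normal form of $t$. -}

module Defs where

open import Data.Nat using (ℕ)
open import Data.Product using (∃; _×_)
open import Data.Empty using (⊥)
open import Relation.Nullary using (¬_)
open import Relation.Binary.Construct.Closure.ReflexiveTransitive using (Star)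

data Term : Set where
  var  : ℕ → Term
  cst  : ℕ → Term
  zro  : Term
  _⊕_  : Term → Term → Term
  h    : Term → Term

infixl 6 _⊕_

-- A +-term: only variables, constants and +, no occurrence of h.
-- (0 is a symbol of the signature; we allow it as it is not h.)
data PlusTerm : Term → Set where
  var : ∀ x → PlusTerm (var x)
  cst : ∀ c → PlusTerm (cst c)
  zro : PlusTerm zro
  _⊕_ : ∀ {s t} → PlusTerm s → PlusTerm t → PlusTerm (s ⊕ t)

Subst : Set
Subst = ℕ → Term

_[_] : Term → Subst → Term
var x [ σ ] = σ x
cst c [ σ ] = cst c
zro   [ σ ] = zro
(s ⊕ t) [ σ ] = (s [ σ ]) ⊕ (t [ σ ])
h t [ σ ] = h (t [ σ ])

data _≈AC_ : Term → Term → Set where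
  refl   : ∀ {t} → t ≈AC t
  sym    : ∀ {s t} → s ≈AC t → t ≈AC s
  trans  : ∀ {s t u} → s ≈AC t → t ≈AC u → s ≈AC u
  assoc  : ∀ x y z → ((x ⊕ y) ⊕ z) ≈AC (x ⊕ (y ⊕ z))
  comm   : ∀ x y → (x ⊕ y) ≈AC (y ⊕ x)
  ⊕-cong : ∀ {s s' t t'} → s ≈AC s' → t ≈AC t' → (s ⊕ t) ≈AC (s' ⊕ t')
  h-cong : ∀ {s t} → s ≈AC t → h s ≈AC h t

data _≈ACh_ : Term → Term → Set where
  refl   : ∀ {t} → t ≈ACh t
  sym    : ∀ {s t} → s ≈ACh t → t ≈ACh s
  trans  : ∀ {s t u} → s ≈ACh t → t ≈ACh u → s ≈ACh u
  assoc  : ∀ x y z → ((x ⊕ y) ⊕ z) ≈ACh (x ⊕ (y ⊕ z))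
  comm   : ∀ x y → (x ⊕ y) ≈ACh (y ⊕ x)
  hom    : ∀ x y → h (x ⊕ y) ≈ACh (h x ⊕ h y)
  ⊕-cong : ∀ {s s' t t'} → s ≈ACh s' → t ≈ACh t' → (s ⊕ t) ≈ACh (s' ⊕ t')
  h-cong : ∀ {s t} → s ≈ACh t → h s ≈ACh h t

_≲AC_ : Term → Term → Set
s ≲AC t = ∃ λ σ → (s [ σ ]) ≈AC t

_≲ACh_ : Term → Term → Set
s ≲ACh t = ∃ λ σ → (s [ σ ]) ≈ACh t

data _⟶Rh_ : Term → Term → Set where
  root : ∀ {u} a b → u ≈AC h (a ⊕ b) → u ⟶Rh (h a ⊕ h b)
  ⊕ˡ   : ∀ {s s'} t → s ⟶Rh s' → (s ⊕ t) ⟶Rh (s' ⊕ t)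
  ⊕ʳ   : ∀ s {t t'} → t ⟶Rh t' → (s ⊕ t) ⟶Rh (s ⊕ t')
  inh  : ∀ {s s'} → s ⟶Rh s' → h s ⟶Rh h s'

_⟶Rh*_ : Term → Term → Set
_⟶Rh*_ = Star _⟶Rh_

IsNormalFormOf : Term → Term → Set
IsNormalFormOf n t = (t ⟶Rh* n) × (¬ ∃ λ u → n ⟶Rh u)

-- Let normalise t be t with every h pushed down to the leaves of its +-structure.
-- It is invariant under ACh up to AC (the axiom h(x+y) ≈ h(x)+h(y) becomes a
-- syntactic identity), it fixes R_h-irreducible terms, and it commutes with
-- instantiating a +-term, which contains no h. So from sσ =ACh t we get
-- s(normalise ∘ σ) = normalise(sσ) =AC normalise t = normalise t↓ = t↓.
-- Conversely AC ⊆ ACh, and t =ACh t↓ because each rewrite step is an ACh-equation.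
module Submission where

open import Defs
open import Data.Product using (_×_; _,_; ∃)
open import Relation.Binary.PropositionalEquality as ≡ using (_≡_)
open import Relation.Binary.Construct.Closure.ReflexiveTransitive using (ε; _◅_)
open import Relation.Nullary using (¬_)
open import Data.Empty using (⊥-elim)

≡⇒≈AC : ∀ {a b} → a ≡ b → a ≈AC b
≡⇒≈AC ≡.refl = refl

≈AC⇒≈ACh : ∀ {a b} → a ≈AC b → a ≈ACh b
≈AC⇒≈ACh refl          = refl
≈AC⇒≈ACh (sym p)       = sym (≈AC⇒≈ACh p)
≈AC⇒≈ACh (trans p q)   = trans (≈AC⇒≈ACh p) (≈AC⇒≈ACh q)
≈AC⇒≈ACh (assoc x y z) = assoc x y z
≈AC⇒≈ACh (comm x y)    = comm x y
≈AC⇒≈ACh (⊕-cong p q)  = ⊕-cong (≈AC⇒≈ACh p) (≈AC⇒≈ACh q)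
≈AC⇒≈ACh (h-cong p)    = h-cong (≈AC⇒≈ACh p)

⟶Rh⇒≈ACh : ∀ {a b} → a ⟶Rh b → a ≈ACh b
⟶Rh⇒≈ACh (root a b p) = trans (≈AC⇒≈ACh p) (hom a b)
⟶Rh⇒≈ACh (⊕ˡ t r)     = ⊕-cong (⟶Rh⇒≈ACh r) refl
⟶Rh⇒≈ACh (⊕ʳ s r)     = ⊕-cong refl (⟶Rh⇒≈ACh r)
⟶Rh⇒≈ACh (inh r)      = h-cong (⟶Rh⇒≈ACh r)

⟶Rh*⇒≈ACh : ∀ {a b} → a ⟶Rh* b → a ≈ACh b
⟶Rh*⇒≈ACh ε        = refl
⟶Rh*⇒≈ACh (r ◅ rs) = trans (⟶Rh⇒≈ACh r) (⟶Rh*⇒≈ACh rs)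

hDistribute : Term → Term
hDistribute (a ⊕ b) = hDistribute a ⊕ hDistribute b
hDistribute t       = h t

normalise : Term → Term
normalise (var x) = var x
normalise (cst c) = cst c
normalise zro     = zro
normalise (a ⊕ b) = normalise a ⊕ normalise b
normalise (h t)   = hDistribute (normalise t)

hDistribute-cong : ∀ {a b} → a ≈AC b → hDistribute a ≈AC hDistribute b
hDistribute-cong refl          = refl
hDistribute-cong (sym p)       = sym (hDistribute-cong p)
hDistribute-cong (trans p q)   = trans (hDistribute-cong p) (hDistribute-cong q)
hDistribute-cong (assoc x y z) = assoc _ _ _
hDistribute-cong (comm x y)    = comm _ _
hDistribute-cong (⊕-cong p q)  = ⊕-cong (hDistribute-cong p) (hDistribute-cong q)
hDistribute-cong (h-cong p)    = h-cong (h-cong p)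

normalise-cong : ∀ {a b} → a ≈ACh b → normalise a ≈AC normalise b
normalise-cong refl          = refl
normalise-cong (sym p)       = sym (normalise-cong p)
normalise-cong (trans p q)   = trans (normalise-cong p) (normalise-cong q)
normalise-cong (assoc x y z) = assoc _ _ _
normalise-cong (comm x y)    = comm _ _
normalise-cong (hom x y)     = refl
normalise-cong (⊕-cong p q)  = ⊕-cong (normalise-cong p) (normalise-cong q)
normalise-cong (h-cong p)    = hDistribute-cong (normalise-cong p)

Irreducible : Term → Set
Irreducible n = ¬ ∃ λ u → n ⟶Rh u

normalise-irreducible : ∀ n → Irreducible n → normalise n ≡ n
normalise-irreducible (var x)     _   = ≡.refl
normalise-irreducible (cst c)     _   = ≡.refl
normalise-irreducible zro         _   = ≡.refl
normalise-irreducible (a ⊕ b)     irr =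
  ≡.cong₂ _⊕_ (normalise-irreducible a (λ (_ , r) → irr (_ , ⊕ˡ b r)))
              (normalise-irreducible b (λ (_ , r) → irr (_ , ⊕ʳ a r)))
normalise-irreducible (h (var x)) _   = ≡.refl
normalise-irreducible (h (cst c)) _   = ≡.refl
normalise-irreducible (h zro)     _   = ≡.refl
normalise-irreducible (h (a ⊕ b)) irr = ⊥-elim (irr (_ , root a b refl))
normalise-irreducible (h (h m))   irr =
  ≡.cong hDistribute (normalise-irreducible (h m) (λ (_ , r) → irr (_ , inh r)))

normalise-[] : ∀ {s} → PlusTerm s → ∀ σ → normalise (s [ σ ]) ≡ s [ (λ x → normalise (σ x)) ]
normalise-[] (var x) σ = ≡.refl
normalise-[] (cst c) σ = ≡.refl
normalise-[] zro     σ = ≡.refl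
normalise-[] (p ⊕ q) σ = ≡.cong₂ _⊕_ (normalise-[] p σ) (normalise-[] q σ)

≲ACh⇒≲AC-normalise : ∀ {s t} → PlusTerm s → s ≲ACh t → s ≲AC normalise t
≲ACh⇒≲AC-normalise ps (σ , sσ≈t) =
  (λ x → normalise (σ x)) , trans (≡⇒≈AC (≡.sym (normalise-[] ps σ))) (normalise-cong sσ≈t)

≲ACh-respʳ : ∀ {s t u} → s ≲ACh t → t ≈ACh u → s ≲ACh u
≲ACh-respʳ (σ , sσ≈t) t≈u = σ , trans sσ≈t t≈u

≲AC⇒≲ACh : ∀ {s t} → s ≲AC t → s ≲ACh t
≲AC⇒≲ACh (σ , sσ≈t) = σ , ≈AC⇒≈ACh sσ≈t

mainTheorem10 : ∀ s t n → PlusTerm s → IsNormalFormOf n t →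
    ((s ≲ACh t → s ≲AC n) × (s ≲AC n → s ≲ACh t))
mainTheorem10 s t n ps (t⟶*n , irr) = forward , backward
  where
  t≈n : t ≈ACh n
  t≈n = ⟶Rh*⇒≈ACh t⟶*n

  forward : s ≲ACh t → s ≲AC n
  forward s≲t with ≲ACh⇒≲AC-normalise ps (≲ACh-respʳ {s} s≲t t≈n)
  ... | σ , sσ≈∣n∣ = σ , trans sσ≈∣n∣ (≡⇒≈AC (normalise-irreducible n irr))

  backward : s ≲AC n → s ≲ACh t
  backward s≲n = ≲ACh-respʳ {s} (≲AC⇒≲ACh {s} s≲n) (sym t≈n)
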